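{- If $G$ is a connected, claw-free, cubic graph, then $\frac{F_t(G)}{F(G)} \le 2$. Moreover, this bound is asymptotically best possible: for every real $\epsilon > 0$ there exists a connected, claw-free, cubic graph $G$ with $\frac{F_t(G)}{F(G)} > 2 - \epsilon$.
   Context: Graphs are finite and simple. A graph is claw-free if it contains no induced $K_{1,3}$. Forcing process: given $S \subseteq V(G)$ of initially colored vertices, at each step, if a colored vertex has exactly one non-colored neighbor, that neighbor becomes colored. $S$ is a forcing set if iterating this process colors all of $V(G)$; $F(G)$ is the minimum size of a forcing set. A total forcing set is a forcing set $S$ such that $G[S]$ has no isolated vertex; $F_t(G)$ is the minimum size of a total forcing set.
   Formalization: In the sharpness clause, ε ranges only over the positive rationals instead of all positive reals. -}

module Defs where

open import Data.Nat using (ℕ; zero; suc; _≤_)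
open import Data.Bool using (Bool; true; false; if_then_else_)
open import Data.Fin using (Fin)
open import Data.Fin.Subset using (Subset; _∈_; ∣_∣; inside; outside)
open import Data.Vec using (tabulate)
open import Data.Product using (Σ; _×_; _,_; ∃)
open import Relation.Binary.PropositionalEquality using (_≡_; _≢_)
open import Relation.Binary.Construct.Closure.ReflexiveTransitive using (Star)
open import Relation.Nullary using (¬_)

record Graph (n : ℕ) : Set where
  field
    adj   : Fin n → Fin n → Bool
    sym   : ∀ u v → adj u v ≡ adj v u
    loopless : ∀ v → adj v v ≡ false

open Graph public

module _ {n : ℕ} (G : Graph n) where

  Adj : Fin n → Fin n → Set
  Adj u v = adj G u v ≡ true

  nbhd : Fin n → Subset n
  nbhd v = tabulate (λ w → if adj G v w then inside else outside)

  degree : Fin n → ℕ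
  degree v = ∣ nbhd v ∣

  Cubic : Set
  Cubic = ∀ v → degree v ≡ 3

  Connected : Set
  Connected = ∀ u v → Star Adj u v

  IsClaw : Fin n → Fin n → Fin n → Fin n → Set
  IsClaw c a b d =
    Adj c a × Adj c b × Adj c d ×
    a ≢ b × a ≢ d × b ≢ d ×
    ¬ Adj a b × ¬ Adj a d × ¬ Adj b d

  ClawFree : Set
  ClawFree = ∀ c a b d → ¬ IsClaw c a b d

  -- The set of vertices coloured by the forcing process started from S:
  -- the least set containing S and closed under the forcing rule
  -- "if u is coloured and v is the only non-coloured neighbour of u,
  --  then v becomes coloured".
  data Colored (S : Subset n) : Fin n → Set where
    initial : ∀ {v} → v ∈ S → Colored S v
    force   : ∀ {u v} → Colored S u → Adj u v →
              (∀ w → Adj u w → w ≢ v → Colored S w) →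
              Colored S v

  IsForcingSet : Subset n → Set
  IsForcingSet S = ∀ v → Colored S v

  NoIsolatedIn : Subset n → Set
  NoIsolatedIn S = ∀ v → v ∈ S → Σ (Fin n) (λ w → w ∈ S × Adj v w)

  IsTotalForcingSet : Subset n → Set
  IsTotalForcingSet S = IsForcingSet S × NoIsolatedIn S

  IsForcingNumber : ℕ → Set
  IsForcingNumber k =
    Σ (Subset n) (λ S → IsForcingSet S × ∣ S ∣ ≡ k) ×
    (∀ S → IsForcingSet S → k ≤ ∣ S ∣)

  IsTotalForcingNumber : ℕ → Set
  IsTotalForcingNumber k =
    Σ (Subset n) (λ S → IsTotalForcingSet S × ∣ S ∣ ≡ k) ×
    (∀ S → IsTotalForcingSet S → k ≤ ∣ S ∣)

  ConnectedClawFreeCubic : Set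
  ConnectedClawFreeCubic = Connected × ClawFree × Cubic

module Submission where

-- Adding to a forcing set S one neighbour of each of its
-- vertices keeps it forcing (colouring is monotone in the initial set) and
-- leaves no isolated vertex, at a cost of at most |S| vertices.
--
-- The necklace of K diamonds (copies of K₄ minus an edge, the
-- ends of consecutive diamonds joined cyclically) is connected, claw-free
-- and cubic, and has F = K + 2 and F_t = 2K.  Lower bounds come from
-- counting per diamond: the two middle vertices of a diamond form a fort,
-- so every forcing set meets them, and the first force of the process
-- needs two further vertices; a total forcing set also contains a
-- neighbour of each such middle vertex, inside the same diamond.  Taking
-- K = 4(d+1) for ε = (a+1)/(d+1) makes (2 - ε)(K + 2) < 2K.

-- It is proved in unnormalised rationals, where it
-- is an inequality between cross-multiplied integers, and transported to ℚ.
module Ratio where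
  open import Data.Nat using (suc; z≤n; s≤s)
  import Data.Nat as ℕ
  import Data.Nat.Properties as ℕ
  open import Data.Nat.Coprimality using (Coprime)
  open import Data.Integer using (ℤ; +_; +[1+_]; _+_; _*_; -_; _<_; +<+)
  import Data.Integer.Properties as ℤ
  open import Data.Integer.Tactic.RingSolver using (solve-∀)
  open import Data.Rational.Unnormalised as ℚᵘ using (mkℚᵘ; *<*)
  import Data.Rational.Unnormalised.Properties as ℚᵘ
  open import Data.Rational as ℚ using (ℚ; mkℚ; _/_; toℚᵘ)
  import Data.Rational.Properties as ℚ
  open import Relation.Binary.PropositionalEquality
    using (_≡_; refl; sym; trans; cong; cong₂; subst; subst₂)

  -- The integer identity behind the ratio bound, with D = d + 1 and
  -- a + 1 the numerator of ε:  (2D - (a+1))(4D + 2) + (a(4D + 2) + 2) = 8D².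
  ratio-identity : ∀ (a D : ℤ) →
    (+ 2 * D + - (+ 1 + a) * + 1) * (+ 4 * D + + 2) * + 1 + (a * (+ 4 * D + + 2) + + 2) ≡ + 4 * D * + 2 * D
  ratio-identity = solve-∀

  ratio-bound-ℚᵘ : ∀ a d K → K ≡ 4 ℕ.* suc d →
    (mkℚᵘ (+ 2) 0 ℚᵘ.+ ℚᵘ.- mkℚᵘ +[1+ a ] d) ℚᵘ.* mkℚᵘ (+ (K ℕ.+ 2)) 0 ℚᵘ.< mkℚᵘ (+ (K ℕ.* 2)) 0
  ratio-bound-ℚᵘ a d K refl = *<* (subst₂ _<_ (sym lhs-form) (sym rhs-form) lhs<rhs)
    where
    D : ℤ
    D = + suc d
    K+2≡ : + (K ℕ.+ 2) ≡ + 4 * D + + 2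
    K+2≡ = trans (ℤ.pos-+ K 2) (cong (_+ + 2) (ℤ.pos-* 4 (suc d)))
    lhs : ℤ
    lhs = (+ 2 * D + - (+ 1 + + a) * + 1) * (+ 4 * D + + 2) * + 1
    lhs-form : (+ 2 * D + - (+ 1 + + a) * + 1) * + (K ℕ.+ 2) * + 1 ≡ lhs
    lhs-form = cong (λ z → (+ 2 * D + - (+ 1 + + a) * + 1) * z * + 1) K+2≡
    rhs-form : + (K ℕ.* 2) * +[1+ (d ℕ.+ 0) ℕ.* 1 ] ≡ + 4 * D * + 2 * D
    rhs-form = cong₂ _*_ (trans (ℤ.pos-* K 2) (cong (_* + 2) (ℤ.pos-* 4 (suc d))))
                         (cong +[1+_] (trans (ℕ.*-identityʳ _) (ℕ.+-identityʳ d)))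
    gap : ℤ
    gap = + a * (+ 4 * D + + 2) + + 2
    gap≡ : + (a ℕ.* (K ℕ.+ 2) ℕ.+ 2) ≡ gap
    gap≡ = trans (ℤ.pos-+ (a ℕ.* (K ℕ.+ 2)) 2)
                 (cong (_+ + 2) (trans (ℤ.pos-* a (K ℕ.+ 2)) (cong (+ a *_) K+2≡)))
    lhs<rhs : lhs < + 4 * D * + 2 * D
    lhs<rhs = subst (lhs <_) (trans (cong (λ z → lhs + z) gap≡) (ratio-identity (+ a) D))
                (subst (_< lhs + + (a ℕ.* (K ℕ.+ 2) ℕ.+ 2)) (ℤ.+-identityʳ lhs)
                       (ℤ.+-monoʳ-< lhs (+<+ (ℕ.≤-trans (s≤s z≤n) (ℕ.m≤n+m 2 _)))))

  toℚᵘ-integer : ∀ n → toℚᵘ ((+ n) / 1) ℚᵘ.≃ mkℚᵘ (+ n) 0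
  toℚᵘ-integer n = ℚ.toℚᵘ-fromℚᵘ (mkℚᵘ (+ n) 0)

  ratio-bound : ∀ a d .(c : Coprime (suc a) (suc d)) K → K ≡ 4 ℕ.* suc d →
    (((+ 2) / 1) ℚ.- mkℚ +[1+ a ] d c) ℚ.* ((+ (K ℕ.+ 2)) / 1) ℚ.< (+ (K ℕ.* 2)) / 1
  ratio-bound a d c K K≡ =
    ℚ.toℚᵘ-cancel-< (ℚᵘ.<-respʳ-≃ (ℚᵘ.≃-sym (toℚᵘ-integer (K ℕ.* 2)))
                      (ℚᵘ.<-respˡ-≃ (ℚᵘ.≃-sym to-unnormalised) (ratio-bound-ℚᵘ a d K K≡)))
    where
    ε : ℚ
    ε = mkℚ +[1+ a ] d c
    to-unnormalised : toℚᵘ ((((+ 2) / 1) ℚ.- ε) ℚ.* ((+ (K ℕ.+ 2)) / 1))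
                      ℚᵘ.≃ (mkℚᵘ (+ 2) 0 ℚᵘ.+ ℚᵘ.- mkℚᵘ +[1+ a ] d) ℚᵘ.* mkℚᵘ (+ (K ℕ.+ 2)) 0
    to-unnormalised =
      ℚᵘ.≃-trans (ℚ.toℚᵘ-homo-* (((+ 2) / 1) ℚ.- ε) ((+ (K ℕ.+ 2)) / 1))
        (ℚᵘ.*-cong (ℚᵘ.≃-trans (ℚ.toℚᵘ-homo-+ ((+ 2) / 1) (ℚ.- ε))
                                (ℚᵘ.+-cong (toℚᵘ-integer 2) (ℚ.toℚᵘ-homo‿- ε)))
                   (toℚᵘ-integer (K ℕ.+ 2)))

open import Defs hiding (sym)
open import Data.Nat using (ℕ; zero; suc; _+_; _*_; _∸_; _≤_; z≤n; s≤s)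
open import Data.Nat.Properties
  using (≤-trans; ≤-reflexive; ≤-antisym; +-mono-≤; +-monoʳ-≤; +-suc; +-comm; +-identityʳ;
         *-identityʳ; m≤m+n; m≤n+m; m+[n∸m]≡n; ∸-monoˡ-≤; 1+n≢n; +-0-commutativeMonoid)
open import Data.Bool using (Bool; true; false; not; if_then_else_)
import Data.Bool
open import Data.Fin using (Fin; zero; suc; fromℕ; inject₁; toℕ; combine; remQuot)
open import Data.Fin.Patterns using (0F; 1F; 2F; 3F)
open import Data.Fin.Properties
  using (_≟_; any?; all?; ¬∀⟶∃¬; toℕ-inject₁; remQuot-combine; combine-remQuot)
open import Data.Fin.Induction using (<-weakInduction)
open import Data.Fin.Subset
  using (Subset; _∈_; _∉_; _⊆_; ∣_∣; inside; outside; _∪_; _─_; ⁅_⁆; ⊥; Nonempty)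
open import Data.Fin.Subset.Properties
  using (_∈?_; ∣p∣≤∣x∷p∣; ∣⁅x⁆∣≡1; ∣⊥∣≡0; p⊆q⇒∣p∣≤∣q∣; x∈p⇒∣p-x∣<∣p∣; x∈p∧x∉q⇒x∈p─q;
         x∈⁅x⁆; x∈⁅y⁆⇒x≡y; p⊆p∪q; q⊆p∪q; x∈p∪q⁺; x∈p∪q⁻; ∉⊥; nonempty?; Empty-unique)
open import Data.Vec using (_∷_; []; _++_; tabulate; lookup; splitAt; here; there)
open import Data.Vec.Properties
  using (lookup∘tabulate; tabulate∘lookup; tabulate-cong; []=⇒lookup; lookup⇒[]=;
         lookup-++ˡ; lookup-++ʳ)
open import Data.Integer using (+_; +0; +[1+_]; -[1+_])
import Data.Integer as ℤ
open import Data.Rational using (ℚ; mkℚ; _/_; _<_; _-_; 0ℚ)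
import Data.Rational as Q
open import Data.Product using (Σ; ∃; _×_; _,_; proj₁; proj₂)
open import Data.Product.Properties using (≡-dec)
open import Data.Sum using (_⊎_; inj₁; inj₂; [_,_]′)
open import Data.Empty using (⊥-elim)
open import Relation.Binary.Definitions using (DecidableEquality)
open import Relation.Binary.PropositionalEquality
  using (_≡_; _≢_; refl; sym; trans; cong; cong₂; subst; subst₂; module ≡-Reasoning)
open import Relation.Binary.Construct.Closure.ReflexiveTransitive using (Star; ε; _◅_; _◅◅_; reverse)
open import Relation.Nullary using (¬_; Dec; does; yes; no; ¬?; _×-dec_; _⊎-dec_)
open import Relation.Nullary.Decidable using (dec-true; dec-false; decidable-stable)
open import Data.Nat.Tactic.RingSolver using (solve-∀)
open import Algebra.Properties.CommutativeMonoid.Sum +-0-commutativeMonoid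
  using (sum; sum-cong-≗; ∑-distrib-+)

∣p∪q∣≤∣p∣+∣q∣ : ∀ {n} (p q : Subset n) → ∣ p ∪ q ∣ ≤ ∣ p ∣ + ∣ q ∣
∣p∪q∣≤∣p∣+∣q∣ []            []            = z≤n
∣p∪q∣≤∣p∣+∣q∣ (true  ∷ p)   (b ∷ q)       =
  s≤s (≤-trans (∣p∪q∣≤∣p∣+∣q∣ p q) (+-monoʳ-≤ ∣ p ∣ (∣p∣≤∣x∷p∣ b q)))
∣p∪q∣≤∣p∣+∣q∣ (false ∷ p)   (true  ∷ q)   =
  ≤-trans (s≤s (∣p∪q∣≤∣p∣+∣q∣ p q)) (≤-reflexive (sym (+-suc ∣ p ∣ ∣ q ∣)))
∣p∪q∣≤∣p∣+∣q∣ (false ∷ p)   (false ∷ q)   = ∣p∪q∣≤∣p∣+∣q∣ p q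

member-count : ∀ {n k} {p : Subset n} {x} → x ∈ p → k ≤ ∣ p ─ ⁅ x ⁆ ∣ → suc k ≤ ∣ p ∣
member-count x∈p k≤ = ≤-trans (s≤s k≤) (x∈p⇒∣p-x∣<∣p∣ x∈p)

∈-remove : ∀ {n} {p : Subset n} {x y} → y ∈ p → x ≢ y → y ∈ p ─ ⁅ x ⁆
∈-remove y∈p x≢y = x∈p∧x∉q⇒x∈p─q y∈p (λ y∈⁅x⁆ → x≢y (sym (x∈⁅y⁆⇒x≡y _ y∈⁅x⁆)))

1≤∣p∣ : ∀ {n} {p : Subset n} {x} → x ∈ p → 1 ≤ ∣ p ∣
1≤∣p∣ x∈p = member-count x∈p z≤n

2≤∣p∣ : ∀ {n} {p : Subset n} {x y} → x ∈ p → y ∈ p → x ≢ y → 2 ≤ ∣ p ∣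
2≤∣p∣ x∈p y∈p x≢y = member-count x∈p (1≤∣p∣ (∈-remove y∈p x≢y))

3≤∣p∣ : ∀ {n} {p : Subset n} {x y z} → x ∈ p → y ∈ p → z ∈ p →
        x ≢ y → x ≢ z → y ≢ z → 3 ≤ ∣ p ∣
3≤∣p∣ x∈p y∈p z∈p x≢y x≢z y≢z =
  member-count x∈p (2≤∣p∣ (∈-remove y∈p x≢y) (∈-remove z∈p x≢z) y≢z)

positive⇒nonempty : ∀ {n} (p : Subset n) → 1 ≤ ∣ p ∣ → Nonempty p
positive⇒nonempty {n} p 1≤ with nonempty? p
... | yes ne = ne
... | no ¬ne = ⊥-elim (1≰0 (subst (1 ≤_) (∣⊥∣≡0 n) (subst (λ q → 1 ≤ ∣ q ∣) (Empty-unique ¬ne) 1≤)))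
  where 1≰0 : ¬ (1 ≤ 0)
        1≰0 ()

∈-tabulate⁺ : ∀ {n} (f : Fin n → Bool) {x} → f x ≡ true → x ∈ tabulate f
∈-tabulate⁺ f {x} fx = lookup⇒[]= x (tabulate f) (trans (lookup∘tabulate f x) fx)

∈-tabulate⁻ : ∀ {n} (f : Fin n → Bool) {x} → x ∈ tabulate f → f x ≡ true
∈-tabulate⁻ f {x} x∈ = trans (sym (lookup∘tabulate f x)) ([]=⇒lookup x∈)

image : ∀ {m n} → (Fin m → Fin n) → Subset m → Subset n
image g []            = ⊥
image g (true  ∷ S)   = ⁅ g zero ⁆ ∪ image (λ v → g (suc v)) S
image g (false ∷ S)   = image (λ v → g (suc v)) S

image⁺ : ∀ {m n} (g : Fin m → Fin n) {S v} → v ∈ S → g v ∈ image g S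
image⁺ g {true  ∷ S} {zero}  _           = x∈p∪q⁺ (inj₁ (x∈⁅x⁆ (g zero)))
image⁺ g {true  ∷ S} {suc v} (there v∈S) = x∈p∪q⁺ (inj₂ (image⁺ (λ v → g (suc v)) v∈S))
image⁺ g {false ∷ S} {suc v} (there v∈S) = image⁺ (λ v → g (suc v)) v∈S

image⁻ : ∀ {m n} (g : Fin m → Fin n) (S : Subset m) {w} → w ∈ image g S →
         ∃ λ v → v ∈ S × g v ≡ w
image⁻ g []          w∈ = ⊥-elim (∉⊥ w∈)
image⁻ g (true ∷ S)  w∈ with x∈p∪q⁻ ⁅ g zero ⁆ _ w∈
... | inj₁ w∈⁅⁆ = zero , here , sym (x∈⁅y⁆⇒x≡y _ w∈⁅⁆)
... | inj₂ w∈I  with image⁻ (λ v → g (suc v)) S w∈I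
...   | v , v∈S , gv≡w = suc v , there v∈S , gv≡w
image⁻ g (false ∷ S) w∈ with image⁻ (λ v → g (suc v)) S w∈
... | v , v∈S , gv≡w = suc v , there v∈S , gv≡w

∣image∣≤∣S∣ : ∀ {m n} (g : Fin m → Fin n) (S : Subset m) → ∣ image g S ∣ ≤ ∣ S ∣
∣image∣≤∣S∣ {n = n} g []  = ≤-reflexive (∣⊥∣≡0 n)
∣image∣≤∣S∣ g (true ∷ S)  =
  ≤-trans (∣p∪q∣≤∣p∣+∣q∣ ⁅ g zero ⁆ _)
          (≤-trans (≤-reflexive (cong (_+ ∣ image (λ v → g (suc v)) S ∣) (∣⁅x⁆∣≡1 (g zero))))
                   (s≤s (∣image∣≤∣S∣ (λ v → g (suc v)) S)))
∣image∣≤∣S∣ g (false ∷ S) = ∣image∣≤∣S∣ (λ v → g (suc v)) S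

∑-const : ∀ n c → sum {n} (λ _ → c) ≡ n * c
∑-const zero    c = refl
∑-const (suc n) c = cong (_+_ c) (∑-const n c)

∑-mono-≤ : ∀ {n} {f g : Fin n → ℕ} → (∀ i → f i ≤ g i) → sum f ≤ sum g
∑-mono-≤ {zero}  f≤g = z≤n
∑-mono-≤ {suc n} f≤g = +-mono-≤ (f≤g zero) (∑-mono-≤ (λ i → f≤g (suc i)))

term≤∑ : ∀ {n} (f : Fin n → ℕ) i → f i ≤ sum f
term≤∑ f zero    = m≤m+n (f zero) _
term≤∑ f (suc i) = ≤-trans (term≤∑ (λ j → f (suc j)) i) (m≤n+m _ (f zero))

two-terms≤∑ : ∀ {n} (f : Fin n → ℕ) {i j} → i ≢ j → f i + f j ≤ sum f
two-terms≤∑ f {zero}  {zero}  i≢j = ⊥-elim (i≢j refl)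
two-terms≤∑ f {zero}  {suc j} i≢j = +-monoʳ-≤ (f zero) (term≤∑ (λ k → f (suc k)) j)
two-terms≤∑ f {suc i} {zero}  i≢j =
  subst (_≤ sum f) (+-comm (f zero) (f (suc i))) (+-monoʳ-≤ (f zero) (term≤∑ (λ k → f (suc k)) i))
two-terms≤∑ f {suc i} {suc j} i≢j =
  ≤-trans (two-terms≤∑ (λ k → f (suc k)) (λ i≡j → i≢j (cong suc i≡j))) (m≤n+m _ (f zero))

∑-positive : ∀ {n} (f : Fin n → ℕ) → (∀ i → 1 ≤ f i) → sum f ≡ n + sum (λ i → f i ∸ 1)
∑-positive {n} f 1≤f = begin
  sum f                                   ≡⟨ sum-cong-≗ (λ i → sym (m+[n∸m]≡n (1≤f i))) ⟩
  sum (λ i → 1 + (f i ∸ 1))               ≡⟨ ∑-distrib-+ (λ _ → 1) (λ i → f i ∸ 1) ⟩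
  sum {n} (λ _ → 1) + sum (λ i → f i ∸ 1)
    ≡⟨ cong (_+ sum (λ i → f i ∸ 1)) (trans (∑-const n 1) (*-identityʳ n)) ⟩
  n + sum (λ i → f i ∸ 1)                 ∎
  where open ≡-Reasoning

-- Terms exceeding one by two in total: one term is at least 3, or two
-- distinct terms are at least 2.
SurplusTwo : ∀ {n} → (Fin n → ℕ) → Set
SurplusTwo f = (∃ λ i → 3 ≤ f i) ⊎ (∃ λ i → ∃ λ j → i ≢ j × 2 ≤ f i × 2 ≤ f j)

∑≥n+2 : ∀ {n} (f : Fin n → ℕ) → (∀ i → 1 ≤ f i) → SurplusTwo f → n + 2 ≤ sum f
∑≥n+2 {n} f 1≤f surplus =
  subst (n + 2 ≤_) (sym (∑-positive f 1≤f)) (+-monoʳ-≤ n (lowered surplus))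
  where
  lowered : SurplusTwo f → 2 ≤ sum (λ i → f i ∸ 1)
  lowered (inj₁ (i , 3≤fi)) = ≤-trans (∸-monoˡ-≤ 1 3≤fi) (term≤∑ (λ k → f k ∸ 1) i)
  lowered (inj₂ (i , j , i≢j , 2≤fi , 2≤fj)) =
    ≤-trans (+-mono-≤ (∸-monoˡ-≤ 1 2≤fi) (∸-monoˡ-≤ 1 2≤fj)) (two-terms≤∑ (λ k → f k ∸ 1) i≢j)

block : ∀ {n} k → Subset (n * k) → Fin n → Subset k
block k S i = tabulate (λ j → lookup S (combine i j))

∣++∣ : ∀ {m n} (p : Subset m) (q : Subset n) → ∣ p ++ q ∣ ≡ ∣ p ∣ + ∣ q ∣
∣++∣ []          q = refl
∣++∣ (true  ∷ p) q = cong suc (∣++∣ p q)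
∣++∣ (false ∷ p) q = ∣++∣ p q

∣S∣≡∑blocks : ∀ n k (S : Subset (n * k)) → ∣ S ∣ ≡ sum (λ i → ∣ block {n} k S i ∣)
∣S∣≡∑blocks zero    k [] = refl
∣S∣≡∑blocks (suc n) k S with splitAt k S
... | first , rest , refl = begin
  ∣ first ++ rest ∣
    ≡⟨ ∣++∣ first rest ⟩
  ∣ first ∣ + ∣ rest ∣
    ≡⟨ cong₂ _+_ (cong ∣_∣ first-block) (∣S∣≡∑blocks n k rest) ⟩
  ∣ block {suc n} k S zero ∣ + sum (λ i → ∣ block {n} k rest i ∣)
    ≡⟨ cong (_+_ ∣ block {suc n} k S zero ∣) (sum-cong-≗ {n} (λ i → cong ∣_∣ (later-block i))) ⟩
  sum (λ i → ∣ block {suc n} k S i ∣)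
    ∎
  where
  open ≡-Reasoning
  first-block : first ≡ block {suc n} k S zero
  first-block = sym (trans (tabulate-cong (lookup-++ˡ first rest)) (tabulate∘lookup first))
  later-block : ∀ i → block {n} k rest i ≡ block {suc n} k S (suc i)
  later-block i = sym (tabulate-cong (λ j → lookup-++ʳ first rest (combine i j)))

module _ {n : ℕ} (G : Graph n) where

  colored-mono : ∀ {S T} → S ⊆ T → ∀ {v} → Colored G S v → Colored G T v
  colored-mono S⊆T (initial v∈S)     = initial (S⊆T v∈S)
  colored-mono S⊆T (force cu uv rest) =
    force (colored-mono S⊆T cu) uv (λ w uw w≢v → colored-mono S⊆T (rest w uw w≢v))

  -- A fort: a set of vertices such that every vertex outside it with a
  -- neighbour inside has a second neighbour inside.  A fort disjoint from
  -- the initial set is never coloured, since a forcing vertex outside the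
  -- fort always sees two uncoloured fort vertices.
  fort-never-colored : ∀ {S} (Fort : Fin n → Set) →
    (∀ v → v ∈ S → ¬ Fort v) →
    (∀ u v → ¬ Fort u → Fort v → Adj G u v → ∃ λ w → Adj G u w × w ≢ v × Fort w) →
    ∀ {v} → Colored G S v → ¬ Fort v
  fort-never-colored Fort disjoint second (initial v∈S) = disjoint _ v∈S
  fort-never-colored Fort disjoint second (force {u} {v} cu uv rest) fort-v
    with second u v (fort-never-colored Fort disjoint second cu) fort-v uv
  ... | w , uw , w≢v , fort-w = fort-never-colored Fort disjoint second (rest w uw w≢v) fort-w

  record FirstForce (S : Subset n) : Set where
    field
      forcer       : Fin n
      forced       : Fin n
      forcer∈S     : forcer ∈ S
      forced∉S     : forced ∉ S
      forcer~forced : Adj G forcer forced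
      others∈S     : ∀ w → Adj G forcer w → w ≢ forced → w ∈ S

  initial-or-first-force : ∀ {S v} → Colored G S v → v ∈ S ⊎ FirstForce S
  initial-or-first-force (initial v∈S) = inj₁ v∈S
  initial-or-first-force {S} (force {u} {v} cu uv rest) with initial-or-first-force cu
  ... | inj₂ ff  = inj₂ ff
  ... | inj₁ u∈S with v ∈? S
  ...   | yes v∈S = inj₁ v∈S
  ...   | no  v∉S with any? (λ w → (adj G u w Data.Bool.≟ true) ×-dec ¬? (w ≟ v) ×-dec ¬? (w ∈? S))
  ...     | yes (w , uw , w≢v , w∉S) = [ (λ w∈S → ⊥-elim (w∉S w∈S)) , inj₂ ]′
                                          (initial-or-first-force (rest w uw w≢v))
  ...     | no  none = inj₂ record
    { forcer = u ; forced = v ; forcer∈S = u∈S ; forced∉S = v∉S ; forcer~forced = uv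
    ; others∈S = λ w uw w≢v → decidable-stable (w ∈? S) (λ w∉S → none (w , uw , w≢v , w∉S)) }

  first-force : ∀ {S} → IsForcingSet G S → (∃ λ v → v ∉ S) → FirstForce S
  first-force forcing (v , v∉S) =
    [ (λ v∈S → ⊥-elim (v∉S v∈S)) , (λ ff → ff) ]′ (initial-or-first-force (forcing v))

  private
    if-inside : ∀ b → (if b then inside else outside) ≡ b
    if-inside true  = refl
    if-inside false = refl

  ∈-nbhd⁻ : ∀ {v w} → w ∈ nbhd G v → Adj G v w
  ∈-nbhd⁻ {v} {w} w∈ = trans (sym (if-inside (adj G v w)))
                             (∈-tabulate⁻ (λ x → if adj G v x then inside else outside) w∈)

  ∈-nbhd⁺ : ∀ {v w} → Adj G v w → w ∈ nbhd G v
  ∈-nbhd⁺ {v} {w} vw = ∈-tabulate⁺ (λ x → if adj G v x then inside else outside)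
                                   (trans (if-inside (adj G v w)) vw)

  cubic⇒neighbour : Cubic G → ∀ v → ∃ λ w → Adj G v w
  cubic⇒neighbour cubic v with positive⇒nonempty (nbhd G v) (subst (1 ≤_) (sym (cubic v)) (s≤s z≤n))
  ... | w , w∈ = w , ∈-nbhd⁻ w∈

  total-forcing-set-from : (∀ v → ∃ λ w → Adj G v w) → ∀ {S} → IsForcingSet G S →
    Σ (Subset n) λ T → IsTotalForcingSet G T × ∣ T ∣ ≤ 2 * ∣ S ∣
  total-forcing-set-from neighbour {S} forcing = S ∪ partners , (total-forcing , no-isolated) , size
    where
    partner : Fin n → Fin n
    partner v = proj₁ (neighbour v)
    partners : Subset n
    partners = image partner S
    total-forcing : IsForcingSet G (S ∪ partners)
    total-forcing v = colored-mono (p⊆p∪q partners) (forcing v)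
    no-isolated : NoIsolatedIn G (S ∪ partners)
    no-isolated v v∈T with x∈p∪q⁻ S partners v∈T
    ... | inj₁ v∈S = partner v , x∈p∪q⁺ (inj₂ (image⁺ partner v∈S)) , proj₂ (neighbour v)
    ... | inj₂ v∈P with image⁻ partner S v∈P
    ...   | u , u∈S , refl = u , x∈p∪q⁺ (inj₁ u∈S) , trans (Graph.sym G (partner u) u) (proj₂ (neighbour u))
    size : ∣ S ∪ partners ∣ ≤ 2 * ∣ S ∣
    size = ≤-trans (∣p∪q∣≤∣p∣+∣q∣ S partners)
                   (subst (∣ S ∣ + ∣ partners ∣ ≤_) (cong (_+_ ∣ S ∣) (sym (+-identityʳ ∣ S ∣)))
                          (+-monoʳ-≤ ∣ S ∣ (∣image∣≤∣S∣ partner S)))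

  Ft≤2F : (∀ v → ∃ λ w → Adj G v w) →
          ∀ {f ft} → IsForcingNumber G f → IsTotalForcingNumber G ft → ft ≤ 2 * f
  Ft≤2F neighbour ((S , forcing , refl) , _) (_ , minimal) with total-forcing-set-from neighbour forcing
  ... | T , total , size = ≤-trans (minimal T total) size

OneOf : {A : Set} → A → A → A → A → Set
OneOf a b c x = x ≡ a ⊎ x ≡ b ⊎ x ≡ c

pair-related : {A : Set} {R : A → A → Set} → (∀ {x y} → R x y → R y x) →
  ∀ {a b x y} → R a b → x ≡ a ⊎ x ≡ b → y ≡ a ⊎ y ≡ b → x ≢ y → R x y
pair-related R-sym Rab (inj₁ refl) (inj₁ refl) x≢y = ⊥-elim (x≢y refl)
pair-related R-sym Rab (inj₁ refl) (inj₂ refl) x≢y = Rab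
pair-related R-sym Rab (inj₂ refl) (inj₁ refl) x≢y = R-sym Rab
pair-related R-sym Rab (inj₂ refl) (inj₂ refl) x≢y = ⊥-elim (x≢y refl)

classify : {A : Set} {a b c w : A} → OneOf a b c w → (w ≡ a ⊎ w ≡ b) ⊎ w ≡ c
classify (inj₁ w≡a)        = inj₁ (inj₁ w≡a)
classify (inj₂ (inj₁ w≡b)) = inj₁ (inj₂ w≡b)
classify (inj₂ (inj₂ w≡c)) = inj₂ w≡c

not-third : {A : Set} {a b c w : A} → OneOf a b c w → w ≢ c → w ≡ a ⊎ w ≡ b
not-third w∈ w≢c with classify w∈
... | inj₁ w∈ab = w∈ab
... | inj₂ w≡c  = ⊥-elim (w≢c w≡c)

-- Three distinct elements of {a, b, c} contain a and b, so two of them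
-- are related when a and b are.
among-three : {A : Set} {R : A → A → Set} → (∀ {x y} → R x y → R y x) →
  ∀ {a b c x y z} → R a b → OneOf a b c x → OneOf a b c y → OneOf a b c z →
  x ≢ y → x ≢ z → y ≢ z → R x y ⊎ R x z ⊎ R y z
among-three R-sym Rab x∈ y∈ z∈ x≢y x≢z y≢z with classify x∈ | classify y∈
... | inj₂ refl  | _         =
  inj₂ (inj₂ (pair-related R-sym Rab (not-third y∈ (λ e → x≢y (sym e)))
                                     (not-third z∈ (λ e → x≢z (sym e))) y≢z))
... | inj₁ x∈ab  | inj₂ refl =
  inj₂ (inj₁ (pair-related R-sym Rab x∈ab (not-third z∈ (λ e → y≢z (sym e))) x≢z))
... | inj₁ x∈ab  | inj₁ y∈ab = inj₁ (pair-related R-sym Rab x∈ab y∈ab x≢y)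

does-⇔ : {A B : Set} (a? : Dec A) (b? : Dec B) → (A → B) → (B → A) → does a? ≡ does b?
does-⇔ (yes a)  b? A→B B→A = sym (dec-true b? (A→B a))
does-⇔ (no ¬a)  b? A→B B→A = sym (dec-false b? (λ b → ¬a (B→A b)))

does-true⇒ : {A : Set} (a? : Dec A) → does a? ≡ true → A
does-true⇒ (yes a) _  = a
does-true⇒ (no _)  ()

-- A graph on Fin N presented through a vertex type V (in bijection with
-- Fin N) and three neighbour functions: q is adjacent to p when it is one
-- of nb₁ p, nb₂ p, nb₃ p.  The neighbour relation must be symmetric and
-- irreflexive.
module NeighbourGraph
  {N : ℕ} {V : Set} (_≟V_ : DecidableEquality V)
  (vtx : V → Fin N) (pos : Fin N → V)
  (pos-vtx : ∀ p → pos (vtx p) ≡ p) (vtx-pos : ∀ u → vtx (pos u) ≡ u)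
  (nb₁ nb₂ nb₃ : V → V)
  (nb-sym : ∀ {p q} → OneOf (nb₁ p) (nb₂ p) (nb₃ p) q → OneOf (nb₁ q) (nb₂ q) (nb₃ q) p)
  (nb-irrefl : ∀ p → ¬ OneOf (nb₁ p) (nb₂ p) (nb₃ p) p)
  where

  Nb : V → V → Set
  Nb p q = OneOf (nb₁ p) (nb₂ p) (nb₃ p) q

  Nb? : ∀ p q → Dec (Nb p q)
  Nb? p q = (q ≟V nb₁ p) ⊎-dec (q ≟V nb₂ p) ⊎-dec (q ≟V nb₃ p)

  graph : Graph N
  graph = record
    { adj      = λ u v → does (Nb? (pos u) (pos v))
    ; sym      = λ u v → does-⇔ (Nb? (pos u) (pos v)) (Nb? (pos v) (pos u)) nb-sym nb-sym
    ; loopless = λ u → dec-false (Nb? (pos u) (pos u)) (nb-irrefl (pos u))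
    }

  ≢-vtx : ∀ {p q} → p ≢ q → vtx p ≢ vtx q
  ≢-vtx {p} {q} p≢q e = p≢q (trans (sym (pos-vtx p)) (trans (cong pos e) (pos-vtx q)))

  ≢-pos : ∀ {u v} → u ≢ v → pos u ≢ pos v
  ≢-pos {u} {v} u≢v e = u≢v (trans (sym (vtx-pos u)) (trans (cong vtx e) (vtx-pos v)))

  Adj⇒Nb : ∀ {u v} → Adj graph u v → Nb (pos u) (pos v)
  Adj⇒Nb {u} {v} = does-true⇒ (Nb? (pos u) (pos v))

  Nb⇒Adj : ∀ {u v} → Nb (pos u) (pos v) → Adj graph u v
  Nb⇒Adj {u} {v} = dec-true (Nb? (pos u) (pos v))

  Nb⇒Adj-vtx : ∀ {p q} → Nb p q → Adj graph (vtx p) (vtx q)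
  Nb⇒Adj-vtx {p} {q} pq = Nb⇒Adj (subst₂ Nb (sym (pos-vtx p)) (sym (pos-vtx q)) pq)

  Adj-vtx⇒Nb : ∀ {p w} → Adj graph (vtx p) w → Nb p (pos w)
  Adj-vtx⇒Nb {p} pw = subst (λ r → Nb r _) (pos-vtx p) (Adj⇒Nb pw)

  cubic : (∀ p → nb₁ p ≢ nb₂ p × nb₁ p ≢ nb₃ p × nb₂ p ≢ nb₃ p) → Cubic graph
  cubic distinct u = ≤-antisym at-most-three at-least-three
    where
    p : V
    p = pos u
    neighbour : ∀ {r} → Nb p r → vtx r ∈ nbhd graph u
    neighbour {r} pr = ∈-nbhd⁺ graph (Nb⇒Adj (subst (Nb p) (sym (pos-vtx r)) pr))
    at-least-three : 3 ≤ degree graph u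
    at-least-three with distinct p
    ... | d₁₂ , d₁₃ , d₂₃ =
      3≤∣p∣ (neighbour (inj₁ refl)) (neighbour (inj₂ (inj₁ refl))) (neighbour (inj₂ (inj₂ refl)))
            (≢-vtx d₁₂) (≢-vtx d₁₃) (≢-vtx d₂₃)
    Three : Subset N
    Three = ⁅ vtx (nb₁ p) ⁆ ∪ (⁅ vtx (nb₂ p) ⁆ ∪ ⁅ vtx (nb₃ p) ⁆)
    singleton : ∀ {w r} → pos w ≡ r → w ∈ ⁅ vtx r ⁆
    singleton {w} refl = subst (_∈ ⁅ vtx (pos w) ⁆) (vtx-pos w) (x∈⁅x⁆ _)
    in-three : ∀ {w} → OneOf (nb₁ p) (nb₂ p) (nb₃ p) (pos w) → w ∈ Three
    in-three (inj₁ e)        = x∈p∪q⁺ (inj₁ (singleton e))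
    in-three (inj₂ (inj₁ e)) = x∈p∪q⁺ (inj₂ (x∈p∪q⁺ (inj₁ (singleton e))))
    in-three (inj₂ (inj₂ e)) = x∈p∪q⁺ (inj₂ (x∈p∪q⁺ (inj₂ (singleton e))))
    ∣⁅⁆∣≤1 : ∀ r → ∣ ⁅ vtx r ⁆ ∣ ≤ 1
    ∣⁅⁆∣≤1 r = ≤-reflexive (∣⁅x⁆∣≡1 (vtx r))
    ∣Three∣≤3 : ∣ Three ∣ ≤ 3
    ∣Three∣≤3 =
      ≤-trans (∣p∪q∣≤∣p∣+∣q∣ ⁅ vtx (nb₁ p) ⁆ _)
        (+-mono-≤ (∣⁅⁆∣≤1 (nb₁ p))
          (≤-trans (∣p∪q∣≤∣p∣+∣q∣ ⁅ vtx (nb₂ p) ⁆ ⁅ vtx (nb₃ p) ⁆)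
                   (+-mono-≤ (∣⁅⁆∣≤1 (nb₂ p)) (∣⁅⁆∣≤1 (nb₃ p)))))
    at-most-three : degree graph u ≤ 3
    at-most-three = ≤-trans (p⊆q⇒∣p∣≤∣q∣ (λ w∈ → in-three (Adj⇒Nb (∈-nbhd⁻ graph w∈)))) ∣Three∣≤3

  -- If the first two neighbours of every vertex are adjacent, no vertex is
  -- the centre of a claw: two of any three neighbours are nb₁ and nb₂.
  claw-free : (∀ p → Nb (nb₁ p) (nb₂ p)) → ClawFree graph
  claw-free adjacent₁₂ c a b d (ca , cb , cd , a≢b , a≢d , b≢d , ¬ab , ¬ad , ¬bd)
    with among-three {R = Nb} nb-sym (adjacent₁₂ (pos c)) (Adj⇒Nb ca) (Adj⇒Nb cb) (Adj⇒Nb cd)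
                     (≢-pos a≢b) (≢-pos a≢d) (≢-pos b≢d)
  ... | inj₁ ab        = ¬ab (Nb⇒Adj ab)
  ... | inj₂ (inj₁ ad) = ¬ad (Nb⇒Adj ad)
  ... | inj₂ (inj₂ bd) = ¬bd (Nb⇒Adj bd)

prev : ∀ {n} → Fin (suc n) → Fin (suc n)
prev zero    = fromℕ _
prev (suc i) = inject₁ i

next : ∀ {n} → Fin (suc n) → Fin (suc n)
next {zero}  zero    = zero
next {suc n} zero    = suc zero
next {suc n} (suc i) = suc-unless-wrapped (next i)
  where
  -- next i is zero exactly when i is the last element, which wraps around
  suc-unless-wrapped : Fin (suc n) → Fin (suc (suc n))
  suc-unless-wrapped zero    = zero
  suc-unless-wrapped (suc j) = suc (suc j)

next-fromℕ : ∀ n → next (fromℕ n) ≡ zero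
next-fromℕ zero    = refl
next-fromℕ (suc n) rewrite next-fromℕ n = refl

next-inject₁ : ∀ {n} (i : Fin (suc n)) → next (inject₁ i) ≡ suc i
next-inject₁ zero                = refl
next-inject₁ {suc n} (suc i) rewrite next-inject₁ i = refl

next-prev : ∀ {n} (i : Fin (suc n)) → next (prev i) ≡ i
next-prev {n} zero = next-fromℕ n
next-prev {suc n} (suc i) = next-inject₁ i

prev-next : ∀ {n} (i : Fin (suc n)) → prev (next i) ≡ i
prev-next {zero}  zero    = refl
prev-next {suc n} zero    = refl
prev-next {suc n} (suc i) with next i | prev-next i
... | zero  | e = cong suc e
... | suc j | e = cong suc e

prev≢ : ∀ {n} (i : Fin (suc (suc n))) → prev i ≢ i
prev≢ zero    ()
prev≢ (suc i) e = 1+n≢n (trans (sym (cong toℕ e)) (toℕ-inject₁ i))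

next≢ : ∀ {n} (i : Fin (suc (suc n))) → i ≢ next i
next≢ i e = prev≢ i (trans (cong prev e) (prev-next i))

-- Diamond i has vertices (i,0), (i,1),
-- (i,2), (i,3) inducing K₄ minus the edge (i,0)(i,3); the end (i,3) is
-- joined to the end (i+1,0) of the next diamond, cyclically.
module Necklace (m : ℕ) where

  K : ℕ
  K = suc (suc m)

  D : Set
  D = Fin K × Fin 4

  -- The three neighbours of each vertex; the first two are adjacent.
  nb₁ nb₂ nb₃ : D → D
  nb₁ (i , 0F) = i , 1F
  nb₁ (i , 1F) = i , 0F
  nb₁ (i , 2F) = i , 0F
  nb₁ (i , 3F) = i , 1F
  nb₂ (i , 0F) = i , 2F
  nb₂ (i , 1F) = i , 2F
  nb₂ (i , 2F) = i , 1F
  nb₂ (i , 3F) = i , 2F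
  nb₃ (i , 0F) = prev i , 3F
  nb₃ (i , 1F) = i , 3F
  nb₃ (i , 2F) = i , 3F
  nb₃ (i , 3F) = next i , 0F

  nb-sym : ∀ {p q} → OneOf (nb₁ p) (nb₂ p) (nb₃ p) q → OneOf (nb₁ q) (nb₂ q) (nb₃ q) p
  nb-sym {i , 0F} (inj₁ refl)        = inj₁ refl
  nb-sym {i , 0F} (inj₂ (inj₁ refl)) = inj₁ refl
  nb-sym {i , 0F} (inj₂ (inj₂ refl)) = inj₂ (inj₂ (cong (_, 0F) (sym (next-prev i))))
  nb-sym {i , 1F} (inj₁ refl)        = inj₁ refl
  nb-sym {i , 1F} (inj₂ (inj₁ refl)) = inj₂ (inj₁ refl)
  nb-sym {i , 1F} (inj₂ (inj₂ refl)) = inj₁ refl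
  nb-sym {i , 2F} (inj₁ refl)        = inj₂ (inj₁ refl)
  nb-sym {i , 2F} (inj₂ (inj₁ refl)) = inj₂ (inj₁ refl)
  nb-sym {i , 2F} (inj₂ (inj₂ refl)) = inj₂ (inj₁ refl)
  nb-sym {i , 3F} (inj₁ refl)        = inj₂ (inj₂ refl)
  nb-sym {i , 3F} (inj₂ (inj₁ refl)) = inj₂ (inj₂ refl)
  nb-sym {i , 3F} (inj₂ (inj₂ refl)) = inj₂ (inj₂ (cong (_, 3F) (sym (prev-next i))))

  nb-irrefl : ∀ p → ¬ OneOf (nb₁ p) (nb₂ p) (nb₃ p) p
  nb-irrefl (i , 0F) (inj₁ ())
  nb-irrefl (i , 0F) (inj₂ (inj₁ ()))
  nb-irrefl (i , 0F) (inj₂ (inj₂ ()))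
  nb-irrefl (i , 1F) (inj₁ ())
  nb-irrefl (i , 1F) (inj₂ (inj₁ ()))
  nb-irrefl (i , 1F) (inj₂ (inj₂ ()))
  nb-irrefl (i , 2F) (inj₁ ())
  nb-irrefl (i , 2F) (inj₂ (inj₁ ()))
  nb-irrefl (i , 2F) (inj₂ (inj₂ ()))
  nb-irrefl (i , 3F) (inj₁ ())
  nb-irrefl (i , 3F) (inj₂ (inj₁ ()))
  nb-irrefl (i , 3F) (inj₂ (inj₂ ()))

  nb-distinct : ∀ p → nb₁ p ≢ nb₂ p × nb₁ p ≢ nb₃ p × nb₂ p ≢ nb₃ p
  nb-distinct (i , 0F) = (λ ()) , (λ ()) , (λ ())
  nb-distinct (i , 1F) = (λ ()) , (λ ()) , (λ ())
  nb-distinct (i , 2F) = (λ ()) , (λ ()) , (λ ())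
  nb-distinct (i , 3F) = (λ ()) , (λ ()) , (λ ())

  vtx : D → Fin (K * 4)
  vtx (i , j) = combine i j

  pos : Fin (K * 4) → D
  pos = remQuot 4

  pos-vtx : ∀ p → pos (vtx p) ≡ p
  pos-vtx (i , j) = remQuot-combine i j

  vtx-pos : ∀ u → vtx (pos u) ≡ u
  vtx-pos = combine-remQuot {K} 4

  open NeighbourGraph (≡-dec _≟_ _≟_) vtx pos pos-vtx vtx-pos nb₁ nb₂ nb₃ nb-sym nb-irrefl public

  nb-adjacent₁₂ : ∀ p → Nb (nb₁ p) (nb₂ p)
  nb-adjacent₁₂ (i , 0F) = inj₂ (inj₁ refl)
  nb-adjacent₁₂ (i , 1F) = inj₂ (inj₁ refl)
  nb-adjacent₁₂ (i , 2F) = inj₁ refl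
  nb-adjacent₁₂ (i , 3F) = inj₂ (inj₁ refl)

  G : Graph (K * 4)
  G = graph

  edge : ∀ {p q} → Nb p q → Star (Adj G) (vtx p) (vtx q)
  edge pq = Nb⇒Adj-vtx pq ◅ ε

  to-entry : ∀ i j → Star (Adj G) (vtx (i , j)) (vtx (i , 0F))
  to-entry i 0F = ε
  to-entry i 1F = edge {i , 1F} (inj₁ refl)
  to-entry i 2F = edge {i , 2F} (inj₁ refl)
  to-entry i 3F = edge {i , 3F} (inj₁ refl) ◅◅ edge {i , 1F} (inj₁ refl)

  entry-to-origin : ∀ i → Star (Adj G) (vtx (i , 0F)) (vtx (zero , 0F))
  entry-to-origin = <-weakInduction (λ i → Star (Adj G) (vtx (i , 0F)) (vtx (zero , 0F))) ε
    (λ i path → edge {suc i , 0F} {inject₁ i , 3F} (inj₂ (inj₂ refl)) ◅◅ to-entry (inject₁ i) 3F ◅◅ path)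

  connected : Connected G
  connected u v = to-origin u ◅◅ reverse (λ {x} {y} xy → trans (Graph.sym G y x) xy) (to-origin v)
    where
    to-origin : ∀ u → Star (Adj G) u (vtx (zero , 0F))
    to-origin u = subst (λ w → Star (Adj G) w (vtx (zero , 0F))) (vtx-pos u)
                        (to-entry (proj₁ (pos u)) (proj₂ (pos u)) ◅◅ entry-to-origin (proj₁ (pos u)))

  connected-claw-free-cubic : ConnectedClawFreeCubic G
  connected-claw-free-cubic = connected , claw-free nb-adjacent₁₂ , cubic nb-distinct

  Col : Subset (K * 4) → D → Set
  Col S p = Colored G S (vtx p)

  force-at : ∀ {S p q} → Col S p → Nb p q → (∀ r → Nb p r → r ≢ q → Col S r) → Col S q
  force-at {S} {p} cp pq others = force cp (Nb⇒Adj-vtx pq) λ w pw w≢q →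
    subst (Colored G S) (vtx-pos w)
          (others (pos w) (Adj-vtx⇒Nb {p} {w} pw) (λ e → w≢q (trans (sym (vtx-pos w)) (cong vtx e))))

  adj-to : ∀ {u} q → Nb (pos u) q → Adj G u (vtx q)
  adj-to {u} q uq = Nb⇒Adj {u} {vtx q} (subst (Nb (pos u)) (sym (pos-vtx q)) uq)

  named∈ : ∀ {S u q} → u ∈ S → pos u ≡ q → vtx q ∈ S
  named∈ {S} {u} u∈ refl = subst (_∈ S) (sym (vtx-pos u)) u∈

  vertexSet : (D → Bool) → Subset (K * 4)
  vertexSet mem = tabulate (λ u → mem (pos u))

  ∈-vertexSet⁺ : ∀ mem {p} → mem p ≡ true → vtx p ∈ vertexSet mem
  ∈-vertexSet⁺ mem {p} e = ∈-tabulate⁺ (λ u → mem (pos u)) (trans (cong mem (pos-vtx p)) e)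

  ∈-vertexSet⁻ : ∀ mem {u} → u ∈ vertexSet mem → mem (pos u) ≡ true
  ∈-vertexSet⁻ mem = ∈-tabulate⁻ (λ u → mem (pos u))

  diamond : Subset (K * 4) → Fin K → Subset 4
  diamond S i = block 4 S i

  load : Subset (K * 4) → Fin K → ℕ
  load S i = ∣ diamond S i ∣

  ∣S∣≡∑load : ∀ S → ∣ S ∣ ≡ sum (load S)
  ∣S∣≡∑load = ∣S∣≡∑blocks K 4

  ∈-diamond : ∀ {S i j} → vtx (i , j) ∈ S → j ∈ diamond S i
  ∈-diamond {S} {i} x∈ = ∈-tabulate⁺ (λ j → lookup S (combine i j)) ([]=⇒lookup x∈)

  diamond-vertexSet : ∀ mem i → diamond (vertexSet mem) i ≡ tabulate (λ j → mem (i , j))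
  diamond-vertexSet mem i = tabulate-cong λ j →
    trans (lookup∘tabulate (λ u → mem (pos u)) (vtx (i , j))) (cong mem (pos-vtx (i , j)))

  two-in-diamond : ∀ {S} i j j′ → vtx (i , j) ∈ S → vtx (i , j′) ∈ S → j ≢ j′ → 2 ≤ load S i
  two-in-diamond {S} i j j′ x∈ y∈ = 2≤∣p∣ (∈-diamond {S} {i} {j} x∈) (∈-diamond {S} {i} {j′} y∈)

  three-in-diamond : ∀ {S} i j j′ j″ → vtx (i , j) ∈ S → vtx (i , j′) ∈ S → vtx (i , j″) ∈ S →
                     j ≢ j′ → j ≢ j″ → j′ ≢ j″ → 3 ≤ load S i
  three-in-diamond {S} i j j′ j″ x∈ y∈ z∈ =
    3≤∣p∣ (∈-diamond {S} {i} {j} x∈) (∈-diamond {S} {i} {j′} y∈) (∈-diamond {S} {i} {j″} z∈)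

  -- Starting from diamond 0, the end (i-1,3) of the previous
  -- diamond forces (i,0), which forces (i,2), after which (i,1) forces (i,3).
  last : Fin K
  last = prev zero

  isOne : D → Bool
  isOne (_ , j) = does (j ≟ 1F)

  ones : Subset (K * 4)
  ones = vertexSet isOne

  ends : Subset (K * 4)
  ends = ⁅ vtx (zero , 0F) ⁆ ∪ ⁅ vtx (last , 3F) ⁆

  SF : Subset (K * 4)
  SF = ones ∪ ends

  one∈SF : ∀ i → vtx (i , 1F) ∈ SF
  one∈SF i = p⊆p∪q ends (∈-vertexSet⁺ isOne {i , 1F} refl)

  origin∈SF : vtx (zero , 0F) ∈ SF
  origin∈SF = q⊆p∪q ones ends (p⊆p∪q ⁅ vtx (last , 3F) ⁆ (x∈⁅x⁆ (vtx (zero , 0F))))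

  last∈SF : vtx (last , 3F) ∈ SF
  last∈SF = q⊆p∪q ones ends (q⊆p∪q ⁅ vtx (zero , 0F) ⁆ ⁅ vtx (last , 3F) ⁆ (x∈⁅x⁆ (vtx (last , 3F))))

  one-colored : ∀ i → Col SF (i , 1F)
  one-colored i = initial (one∈SF i)

  Full : Fin K → Set
  Full i = Col SF (i , 0F) × Col SF (i , 2F) × Col SF (i , 3F)

  fill : ∀ {i} → Col SF (i , 0F) → Col SF (prev i , 3F) → Full i
  fill {i} c₀ c₃′ = c₀ , c₂ , c₃
    where
    c₂ : Col SF (i , 2F)
    c₂ = force-at {SF} {i , 0F} c₀ (inj₂ (inj₁ refl)) λ
      { r (inj₁ refl)        _   → one-colored i
      ; r (inj₂ (inj₁ refl)) r≢q → ⊥-elim (r≢q refl)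
      ; r (inj₂ (inj₂ refl)) _   → c₃′ }
    c₃ : Col SF (i , 3F)
    c₃ = force-at {SF} {i , 1F} (one-colored i) (inj₂ (inj₂ refl)) λ
      { r (inj₁ refl)        _   → c₀
      ; r (inj₂ (inj₁ refl)) _   → c₂
      ; r (inj₂ (inj₂ refl)) r≢q → ⊥-elim (r≢q refl) }

  enter : ∀ i → Full (prev i) → Col SF (i , 0F)
  enter i (_ , c₂ , c₃) =
    force-at {SF} {prev i , 3F} c₃ (inj₂ (inj₂ (cong (_, 0F) (sym (next-prev i))))) λ
      { r (inj₁ refl)        _   → one-colored (prev i)
      ; r (inj₂ (inj₁ refl)) _   → c₂
      ; r (inj₂ (inj₂ refl)) r≢q → ⊥-elim (r≢q (cong (_, 0F) (next-prev i))) }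

  all-full : ∀ i → Full i
  all-full = <-weakInduction Full
    (fill {zero} (initial origin∈SF) (initial last∈SF))
    (λ i full → fill {suc i} (enter (suc i) full) (proj₂ (proj₂ full)))

  SF-forcing : IsForcingSet G SF
  SF-forcing u = subst (Colored G SF) (vtx-pos u) (colored (pos u))
    where
    colored : ∀ p → Col SF p
    colored (i , 0F) = proj₁ (all-full i)
    colored (i , 1F) = one-colored i
    colored (i , 2F) = proj₁ (proj₂ (all-full i))
    colored (i , 3F) = proj₂ (proj₂ (all-full i))

  ∣ones∣ : ∣ ones ∣ ≡ K
  ∣ones∣ = begin
    ∣ ones ∣            ≡⟨ ∣S∣≡∑load ones ⟩
    sum (load ones)     ≡⟨ sum-cong-≗ (λ i → cong ∣_∣ (diamond-vertexSet isOne i)) ⟩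
    sum {K} (λ _ → 1)   ≡⟨ trans (∑-const K 1) (*-identityʳ K) ⟩
    K                   ∎
    where open ≡-Reasoning

  ∣SF∣≤K+2 : ∣ SF ∣ ≤ K + 2
  ∣SF∣≤K+2 =
    ≤-trans (∣p∪q∣≤∣p∣+∣q∣ ones ends)
      (+-mono-≤ (≤-reflexive ∣ones∣)
        (≤-trans (∣p∪q∣≤∣p∣+∣q∣ ⁅ vtx (zero , 0F) ⁆ ⁅ vtx (last , 3F) ⁆)
                 (+-mono-≤ (≤-reflexive (∣⁅x⁆∣≡1 (vtx (zero , 0F))))
                           (≤-reflexive (∣⁅x⁆∣≡1 (vtx (last , 3F)))))))

  -- Lower bound for forcing sets.  The middle pair {(i,1), (i,2)} of each
  -- diamond is a fort (its outer neighbours see both middle vertices), so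
  -- every forcing set meets it.
  outer-sees-both-middles : ∀ {i p} → Nb (i , 1F) p ⊎ Nb (i , 2F) p → p ≢ (i , 1F) → p ≢ (i , 2F) →
                            Nb p (i , 1F) × Nb p (i , 2F)
  outer-sees-both-middles (inj₁ (inj₁ refl))        _   _   = inj₁ refl , inj₂ (inj₁ refl)
  outer-sees-both-middles (inj₁ (inj₂ (inj₁ refl))) _   p≢₂ = ⊥-elim (p≢₂ refl)
  outer-sees-both-middles (inj₁ (inj₂ (inj₂ refl))) _   _   = inj₁ refl , inj₂ (inj₁ refl)
  outer-sees-both-middles (inj₂ (inj₁ refl))        _   _   = inj₁ refl , inj₂ (inj₁ refl)
  outer-sees-both-middles (inj₂ (inj₂ (inj₁ refl))) p≢₁ _   = ⊥-elim (p≢₁ refl)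
  outer-sees-both-middles (inj₂ (inj₂ (inj₂ refl))) _   _   = inj₁ refl , inj₂ (inj₁ refl)

  middle-in-forcing-set : ∀ {S} → IsForcingSet G S → ∀ i → vtx (i , 1F) ∈ S ⊎ vtx (i , 2F) ∈ S
  middle-in-forcing-set {S} forcing i with vtx (i , 1F) ∈? S | vtx (i , 2F) ∈? S
  ... | yes one∈ | _        = inj₁ one∈
  ... | no _     | yes two∈ = inj₂ two∈
  ... | no one∉  | no two∉  =
    ⊥-elim (fort-never-colored G Middle disjoint second (forcing (vtx (i , 1F))) (inj₁ (pos-vtx (i , 1F))))
    where
    Middle : Fin (K * 4) → Set
    Middle u = pos u ≡ (i , 1F) ⊎ pos u ≡ (i , 2F)
    disjoint : ∀ u → u ∈ S → ¬ Middle u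
    disjoint u u∈ (inj₁ e) = one∉ (named∈ u∈ e)
    disjoint u u∈ (inj₂ e) = two∉ (named∈ u∈ e)
    sees-both : ∀ {u v} → ¬ Middle u → Middle v → Adj G u v → Nb (pos u) (i , 1F) × Nb (pos u) (i , 2F)
    sees-both {u} {v} ¬mu mv uv =
      outer-sees-both-middles (from-middle mv) (λ e → ¬mu (inj₁ e)) (λ e → ¬mu (inj₂ e))
      where
      from-middle : Middle v → Nb (i , 1F) (pos u) ⊎ Nb (i , 2F) (pos u)
      from-middle (inj₁ e) = inj₁ (subst (λ r → Nb r (pos u)) e (nb-sym (Adj⇒Nb {u} {v} uv)))
      from-middle (inj₂ e) = inj₂ (subst (λ r → Nb r (pos u)) e (nb-sym (Adj⇒Nb {u} {v} uv)))
    second : ∀ u v → ¬ Middle u → Middle v → Adj G u v → ∃ λ w → Adj G u w × w ≢ v × Middle w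
    second u v ¬mu (inj₁ v₁) uv =
      vtx (i , 2F) , adj-to {u} (i , 2F) (proj₂ (sees-both {u} {v} ¬mu (inj₁ v₁) uv)) ,
      (λ e → 2≢1 (trans (sym (pos-vtx (i , 2F))) (trans (cong pos e) v₁))) , inj₂ (pos-vtx (i , 2F))
      where 2≢1 : (i , 2F) ≢ (i , 1F)
            2≢1 ()
    second u v ¬mu (inj₂ v₂) uv =
      vtx (i , 1F) , adj-to {u} (i , 1F) (proj₁ (sees-both {u} {v} ¬mu (inj₂ v₂) uv)) ,
      (λ e → 1≢2 (trans (sym (pos-vtx (i , 1F))) (trans (cong pos e) v₂))) , inj₁ (pos-vtx (i , 1F))
      where 1≢2 : (i , 1F) ≢ (i , 2F)
            1≢2 ()

  end-load : ∀ {S} → IsForcingSet G S → ∀ i j → vtx (i , j) ∈ S → j ≢ 1F → j ≢ 2F → 2 ≤ load S i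
  end-load {S} forcing i j x∈ j≢1 j≢2 with middle-in-forcing-set forcing i
  ... | inj₁ one∈ = two-in-diamond i j 1F x∈ one∈ j≢1
  ... | inj₂ two∈ = two-in-diamond i j 2F x∈ two∈ j≢2

  -- A force from p to q needs p and its other two neighbours in S: three
  -- vertices of one diamond, or two in each of two adjacent diamonds.
  surplus-from-force : ∀ {S} → IsForcingSet G S → ∀ p q → Nb p q → vtx p ∈ S →
                       (∀ r → Nb p r → r ≢ q → vtx r ∈ S) → SurplusTwo (load S)
  surplus-from-force {S} forcing (i , 0F) _ (inj₁ refl) p∈ others =
    inj₂ (i , prev i , (λ e → prev≢ i (sym e)) ,
          two-in-diamond i 0F 2F p∈ (others (i , 2F) (inj₂ (inj₁ refl)) (λ ())) (λ ()) ,
          end-load forcing (prev i) 3F (others (prev i , 3F) (inj₂ (inj₂ refl)) (λ ())) (λ ()) (λ ()))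
  surplus-from-force {S} forcing (i , 0F) _ (inj₂ (inj₁ refl)) p∈ others =
    inj₂ (i , prev i , (λ e → prev≢ i (sym e)) ,
          two-in-diamond i 0F 1F p∈ (others (i , 1F) (inj₁ refl) (λ ())) (λ ()) ,
          end-load forcing (prev i) 3F (others (prev i , 3F) (inj₂ (inj₂ refl)) (λ ())) (λ ()) (λ ()))
  surplus-from-force {S} forcing (i , 0F) _ (inj₂ (inj₂ refl)) p∈ others =
    inj₁ (i , three-in-diamond i 0F 1F 2F p∈
                (others (i , 1F) (inj₁ refl) (λ ()))
                (others (i , 2F) (inj₂ (inj₁ refl)) (λ ()))
                (λ ()) (λ ()) (λ ()))
  surplus-from-force {S} forcing (i , 1F) _ (inj₁ refl) p∈ others =
    inj₁ (i , three-in-diamond i 1F 2F 3F p∈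
                (others (i , 2F) (inj₂ (inj₁ refl)) (λ ()))
                (others (i , 3F) (inj₂ (inj₂ refl)) (λ ()))
                (λ ()) (λ ()) (λ ()))
  surplus-from-force {S} forcing (i , 1F) _ (inj₂ (inj₁ refl)) p∈ others =
    inj₁ (i , three-in-diamond i 1F 0F 3F p∈
                (others (i , 0F) (inj₁ refl) (λ ()))
                (others (i , 3F) (inj₂ (inj₂ refl)) (λ ()))
                (λ ()) (λ ()) (λ ()))
  surplus-from-force {S} forcing (i , 1F) _ (inj₂ (inj₂ refl)) p∈ others =
    inj₁ (i , three-in-diamond i 1F 0F 2F p∈
                (others (i , 0F) (inj₁ refl) (λ ()))
                (others (i , 2F) (inj₂ (inj₁ refl)) (λ ()))
                (λ ()) (λ ()) (λ ()))
  surplus-from-force {S} forcing (i , 2F) _ (inj₁ refl) p∈ others =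
    inj₁ (i , three-in-diamond i 2F 1F 3F p∈
                (others (i , 1F) (inj₂ (inj₁ refl)) (λ ()))
                (others (i , 3F) (inj₂ (inj₂ refl)) (λ ()))
                (λ ()) (λ ()) (λ ()))
  surplus-from-force {S} forcing (i , 2F) _ (inj₂ (inj₁ refl)) p∈ others =
    inj₁ (i , three-in-diamond i 2F 0F 3F p∈
                (others (i , 0F) (inj₁ refl) (λ ()))
                (others (i , 3F) (inj₂ (inj₂ refl)) (λ ()))
                (λ ()) (λ ()) (λ ()))
  surplus-from-force {S} forcing (i , 2F) _ (inj₂ (inj₂ refl)) p∈ others =
    inj₁ (i , three-in-diamond i 2F 0F 1F p∈
                (others (i , 0F) (inj₁ refl) (λ ()))
                (others (i , 1F) (inj₂ (inj₁ refl)) (λ ()))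
                (λ ()) (λ ()) (λ ()))
  surplus-from-force {S} forcing (i , 3F) _ (inj₁ refl) p∈ others =
    inj₂ (i , next i , next≢ i ,
          two-in-diamond i 3F 2F p∈ (others (i , 2F) (inj₂ (inj₁ refl)) (λ ())) (λ ()) ,
          end-load forcing (next i) 0F (others (next i , 0F) (inj₂ (inj₂ refl)) (λ ())) (λ ()) (λ ()))
  surplus-from-force {S} forcing (i , 3F) _ (inj₂ (inj₁ refl)) p∈ others =
    inj₂ (i , next i , next≢ i ,
          two-in-diamond i 3F 1F p∈ (others (i , 1F) (inj₁ refl) (λ ())) (λ ()) ,
          end-load forcing (next i) 0F (others (next i , 0F) (inj₂ (inj₂ refl)) (λ ())) (λ ()) (λ ()))
  surplus-from-force {S} forcing (i , 3F) _ (inj₂ (inj₂ refl)) p∈ others =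
    inj₁ (i , three-in-diamond i 3F 1F 2F p∈
                (others (i , 1F) (inj₁ refl) (λ ()))
                (others (i , 2F) (inj₂ (inj₁ refl)) (λ ()))
                (λ ()) (λ ()) (λ ()))

  -- Beyond one vertex per diamond, a forcing set has two more: from its
  -- first force, or, if it is everything, inside diamond 0.
  surplus : ∀ {S} → IsForcingSet G S → SurplusTwo (load S)
  surplus {S} forcing with all? (_∈? S)
  ... | yes all∈ =
    inj₁ (zero , three-in-diamond zero 0F 1F 2F (all∈ _) (all∈ _) (all∈ _) (λ ()) (λ ()) (λ ()))
  ... | no ¬all∈ =
    surplus-from-force forcing (pos forcer) (pos forced) (Adj⇒Nb {forcer} {forced} forcer~forced)
                       (named∈ forcer∈S refl) others-named
    where
    open FirstForce (first-force G forcing (¬∀⟶∃¬ _ (_∈ S) (_∈? S) ¬all∈))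
    others-named : ∀ r → Nb (pos forcer) r → r ≢ pos forced → vtx r ∈ S
    others-named r pr r≢q =
      others∈S (vtx r) (adj-to {forcer} r pr) (λ e → r≢q (trans (sym (pos-vtx r)) (cong pos e)))

  -- F = K + 2: the load is at least one per diamond plus the surplus of two.
  forcing-lower-bound : ∀ S → IsForcingSet G S → K + 2 ≤ ∣ S ∣
  forcing-lower-bound S forcing =
    subst (K + 2 ≤_) (sym (∣S∣≡∑load S))
          (∑≥n+2 (load S) (λ i → middle-load i (middle-in-forcing-set forcing i)) (surplus forcing))
    where
    middle-load : ∀ i → vtx (i , 1F) ∈ S ⊎ vtx (i , 2F) ∈ S → 1 ≤ load S i
    middle-load i (inj₁ one∈) = 1≤∣p∣ (∈-diamond {S} {i} {1F} one∈)
    middle-load i (inj₂ two∈) = 1≤∣p∣ (∈-diamond {S} {i} {2F} two∈)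

  forcing-number : IsForcingNumber G (K + 2)
  forcing-number =
    (SF , SF-forcing , ≤-antisym ∣SF∣≤K+2 (forcing-lower-bound SF SF-forcing)) , forcing-lower-bound

  -- A total forcing set of size 2K: the forcing set above together with
  -- every entry (i,0) except the last one; each diamond then holds (i,0),(i,1)
  -- or, for the last diamond, (i,1),(i,3).
  isLast : Fin K → Bool
  isLast i = does (i ≟ last)

  inST : D → Bool
  inST (i , 0F) = not (isLast i)
  inST (i , 1F) = true
  inST (i , 2F) = false
  inST (i , 3F) = isLast i

  ST : Subset (K * 4)
  ST = vertexSet inST

  SF⊆ST : SF ⊆ ST
  SF⊆ST {u} u∈ with x∈p∪q⁻ ones ends u∈
  ... | inj₁ u∈ones = ∈-tabulate⁺ (λ v → inST (pos v)) (one⇒ST (pos u) (∈-vertexSet⁻ isOne u∈ones))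
    where
    one⇒ST : ∀ p → isOne p ≡ true → inST p ≡ true
    one⇒ST (i , 1F) _ = refl
  ... | inj₂ u∈ends with x∈p∪q⁻ ⁅ vtx (zero , 0F) ⁆ ⁅ vtx (last , 3F) ⁆ u∈ends
  ...   | inj₁ u∈⁅⁆ rewrite x∈⁅y⁆⇒x≡y _ u∈⁅⁆ = ∈-vertexSet⁺ inST {zero , 0F} refl
  ...   | inj₂ u∈⁅⁆ rewrite x∈⁅y⁆⇒x≡y _ u∈⁅⁆ = ∈-vertexSet⁺ inST {last , 3F} (dec-true (last ≟ last) refl)

  partner-in-ST : ∀ p → inST p ≡ true → ∃ λ q → Nb p q × inST q ≡ true
  partner-in-ST (i , 0F) _ = (i , 1F) , inj₁ refl , refl
  partner-in-ST (i , 1F) _ with isLast i in last?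
  ... | true  = (i , 3F) , inj₂ (inj₂ refl) , last?
  ... | false = (i , 0F) , inj₁ refl , cong not last?
  partner-in-ST (i , 3F) _ = (i , 1F) , inj₁ refl , refl

  ST-total : IsTotalForcingSet G ST
  ST-total = (λ u → colored-mono G SF⊆ST (SF-forcing u)) , no-isolated
    where
    no-isolated : NoIsolatedIn G ST
    no-isolated u u∈ with partner-in-ST (pos u) (∈-vertexSet⁻ inST u∈)
    ... | q , uq , q∈ = vtx q , ∈-vertexSet⁺ inST {q} q∈ , adj-to {u} q uq

  ∣ST∣ : ∣ ST ∣ ≡ K * 2
  ∣ST∣ = begin
    ∣ ST ∣             ≡⟨ ∣S∣≡∑load ST ⟩
    sum (load ST)      ≡⟨ sum-cong-≗ (λ i → trans (cong ∣_∣ (diamond-vertexSet inST i))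
                                                (two-per-diamond (isLast i))) ⟩
    sum {K} (λ _ → 2)  ≡⟨ ∑-const K 2 ⟩
    K * 2              ∎
    where
    open ≡-Reasoning
    two-per-diamond : ∀ b → ∣ not b ∷ true ∷ false ∷ b ∷ [] ∣ ≡ 2
    two-per-diamond true  = refl
    two-per-diamond false = refl

  -- Lower bound for total forcing sets: the middle vertex of a diamond in
  -- the set has a neighbour in the set, and it lies in the same diamond.
  middle-neighbour : ∀ {i j q} → j ≡ 1F ⊎ j ≡ 2F → Nb (i , j) q → ∃ λ j′ → q ≡ (i , j′) × j ≢ j′
  middle-neighbour (inj₁ refl) (inj₁ refl)        = 0F , refl , λ ()
  middle-neighbour (inj₁ refl) (inj₂ (inj₁ refl)) = 2F , refl , λ ()
  middle-neighbour (inj₁ refl) (inj₂ (inj₂ refl)) = 3F , refl , λ ()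
  middle-neighbour (inj₂ refl) (inj₁ refl)        = 0F , refl , λ ()
  middle-neighbour (inj₂ refl) (inj₂ (inj₁ refl)) = 1F , refl , λ ()
  middle-neighbour (inj₂ refl) (inj₂ (inj₂ refl)) = 3F , refl , λ ()

  total-forcing-lower-bound : ∀ S → IsTotalForcingSet G S → K * 2 ≤ ∣ S ∣
  total-forcing-lower-bound S (forcing , no-isolated) =
    subst (K * 2 ≤_) (sym (∣S∣≡∑load S))
          (subst (_≤ sum (load S)) (∑-const K 2)
                 (∑-mono-≤ (λ i → two-per-diamond i (middle-in-forcing-set forcing i))))
    where
    with-neighbour : ∀ i j → j ≡ 1F ⊎ j ≡ 2F → vtx (i , j) ∈ S → 2 ≤ load S i
    with-neighbour i j middle x∈ with no-isolated (vtx (i , j)) x∈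
    ... | w , w∈ , xw with middle-neighbour middle (Adj-vtx⇒Nb {i , j} {w} xw)
    ...   | j′ , w≡ , j≢j′ = two-in-diamond i j j′ x∈ (named∈ w∈ w≡) j≢j′
    two-per-diamond : ∀ i → vtx (i , 1F) ∈ S ⊎ vtx (i , 2F) ∈ S → 2 ≤ load S i
    two-per-diamond i (inj₁ one∈) = with-neighbour i 1F (inj₁ refl) one∈
    two-per-diamond i (inj₂ two∈) = with-neighbour i 2F (inj₂ refl) two∈

  total-forcing-number : IsTotalForcingNumber G (K * 2)
  total-forcing-number = (ST , ST-total , ∣ST∣) , total-forcing-lower-bound

necklace-size : ∀ d → suc (suc (4 * d + 2)) ≡ 4 * suc d
necklace-size = solve-∀

necklace-witness : (ε : ℚ) → 0ℚ < ε →
  Σ ℕ (λ n → Σ (Graph n) (λ G → ConnectedClawFreeCubic G ×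
    Σ ℕ (λ f → Σ ℕ (λ ft → IsForcingNumber G f × IsTotalForcingNumber G ft ×
      (((+ 2) / 1) - ε) Q.* ((+ f) / 1) < (+ ft) / 1))))
necklace-witness (mkℚ +[1+ a ] d c) _ =
  K * 4 , G , connected-claw-free-cubic , K + 2 , K * 2 , forcing-number , total-forcing-number ,
  Ratio.ratio-bound a d c K K≡4[d+1]
  where
  open Necklace (4 * d + 2)
  K≡4[d+1] : K ≡ 4 * suc d
  K≡4[d+1] = necklace-size d
necklace-witness (mkℚ +0       d c) 0<ε = ⊥-elim (ℤ.Positive.pos (Q.positive 0<ε))
necklace-witness (mkℚ -[1+ _ ] d c) 0<ε = ⊥-elim (ℤ.Positive.pos (Q.positive 0<ε))

theorem4 :
    ((n : ℕ) (G : Graph n) → ConnectedClawFreeCubic G →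
      (f ft : ℕ) → IsForcingNumber G f → IsTotalForcingNumber G ft →
      ft ≤ 2 * f)
    ×
    ((ε : ℚ) → 0ℚ < ε →
      Σ ℕ (λ n → Σ (Graph n) (λ G → ConnectedClawFreeCubic G ×
        Σ ℕ (λ f → Σ ℕ (λ ft → IsForcingNumber G f × IsTotalForcingNumber G ft ×
          (((+ 2) / 1) - ε) Q.* ((+ f) / 1) < (+ ft) / 1)))))
theorem4 = upper-bound , necklace-witness
  where
  upper-bound : (n : ℕ) (G : Graph n) → ConnectedClawFreeCubic G →
                (f ft : ℕ) → IsForcingNumber G f → IsTotalForcingNumber G ft → ft ≤ 2 * f
  upper-bound n G (_ , _ , cubic) f ft = Ft≤2F G (cubic⇒neighbour G cubic)
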